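{- For every $k\ge 3$, let $A_k=S_{k-2}$ and $B_k=\widehat{A_k}$, and let $\alpha$ be any proper cyclic rotation of $A_k$. Then the numbers of occurrences of $\alpha$ in $A_kA_kA_k$, in $A_kB_k$, and in $B_kA_k$ are $2$, $1$, and $0$, respectively.
   Context: Strings are over the binary alphabet $\{a,b\}$. For $c\in\{a,b\}$, $\overline{c}$ is the other letter; for a nonempty string $w$, $\widehat{w} = w[1..|w|-1]\cdot\overline{w[|w|]}$. The period-doubling sequences are $S_0=a$ and $S_k = S_{k-1}\widehat{S_{k-1}}$ for $k\ge 1$. For $1\le i\le |w|$, $w[i..|w|]\cdot w[1..i-1]$ is a cyclic rotation of $w$; it is proper if it is not equal to $w$. -}

module Defs where

open import Data.Nat using (ℕ; zero; suc; _+_)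
open import Data.List using (List; []; _∷_; _++_; take; drop; length)
open import Data.Bool using (Bool; true; false; if_then_else_)
open import Relation.Binary.PropositionalEquality using (_≡_; refl)

data Letter : Set where
  a b : Letter

flip : Letter → Letter
flip a = b
flip b = a

Word : Set
Word = List Letter

-- ŵ : flip the last letter (identity on the empty word, which never occurs)
hat : Word → Word
hat [] = []
hat (x ∷ []) = flip x ∷ []
hat (x ∷ y ∷ w) = x ∷ hat (y ∷ w)

-- period-doubling words: S 0 = a, S (k+1) = S k · hat (S k)
S : ℕ → Word
S zero = a ∷ []
S (suc k) = S k ++ hat (S k)

isPrefix : Word → Word → Bool
isPrefix [] v = true
isPrefix (x ∷ u) [] = false
isPrefix (a ∷ u) (a ∷ v) = isPrefix u v
isPrefix (b ∷ u) (b ∷ v) = isPrefix u v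
isPrefix (a ∷ u) (b ∷ v) = false
isPrefix (b ∷ u) (a ∷ v) = false

-- number of (possibly overlapping) occurrences of u in w:
-- the number of positions i (0 ≤ i ≤ |w|) with u a prefix of w[i..]
occ : Word → Word → ℕ
occ u [] = if isPrefix u [] then 1 else 0
occ u (x ∷ w) = (if isPrefix u (x ∷ w) then 1 else 0) + occ u w

-- cyclic rotation w[i..|w|] · w[1..i-1] (1-based i), written with shift j = i - 1
rotate : ℕ → Word → Word
rotate j w = drop j w ++ take j w

-- When z agrees with A on its first |A| − 1
-- letters (z = A·A, A or Â), the length-|A| factor of A·z starting at i < |A| is the rotation
-- of A by i, so α occurs there iff that rotation is α. The rotations of S n are pairwise
-- distinct: two equal ones give S n a cyclic period d < 2^n, hence by Bézout the period
-- gcd(d, 2^n), which divides 2^(n−1); but S n = S(n−1)·Ŝ(n−1) differs from its half-turn in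
-- one letter. So each leading copy of A holds exactly one start of α, and a trailing A or Â
-- none, giving 2 and 1. In Â·A no start lies in Â, since every rotation of Â has one b more or
-- fewer than α.
module Submission where

open import Defs
open import Data.Bool using (Bool; true; false; if_then_else_)
open import Data.Bool.Properties using (¬-not)
open import Data.Empty using (⊥-elim)
open import Data.List using ([]; _∷_; _++_; length; take; drop)
open import Data.List.Properties using (length-++; length-drop; take-all; take++drop≡id; ∷-injectiveʳ; ++-identityʳ)
open import Data.Nat using (ℕ; zero; suc; _+_; _*_; _^_; _∸_; _<_; _≤_; z≤n; s≤s; NonZero; >-nonZero; _%_; _/_)
open import Data.Nat.Properties
open import Data.Nat.DivMod using ([m+kn]%n≡m%n; m<n⇒m%n≡m; m≡m%n+[m/n]*n; m%n<n)
open import Data.Nat.Divisibility using (_∣_; divides; ∣⇒≤; *-monoˡ-∣; 0∣⇒≡0)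
open import Data.Nat.GCD using (gcd; gcd-GCD; gcd[m,n]∣m; gcd[m,n]∣n; module Bézout)
open import Data.Nat.Primality using (euclidsLemma; prime[2])
open import Data.Nat.Tactic.RingSolver using (solve-∀)
open import Data.Product using (_×_; _,_)
open import Data.Sum using (inj₁; inj₂)
open import Function using (_∘_; _⇔_; mk⇔; Equivalence)
open import Relation.Nullary using (¬_; yes; no)
open import Relation.Binary using (tri<; tri≈; tri>)
open import Relation.Binary.PropositionalEquality

-- Out-of-range indices read the junk letter a; every use below is in range.
at : Word → ℕ → Letter
at []      _       = a
at (x ∷ w) zero    = x
at (x ∷ w) (suc i) = at w i

at-++ˡ : ∀ (u v : Word) {i} → i < length u → at (u ++ v) i ≡ at u i
at-++ˡ (x ∷ u) v {zero}  _         = refl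
at-++ˡ (x ∷ u) v {suc i} (s≤s i<u) = at-++ˡ u v i<u

at-++ʳ : ∀ (u v : Word) {i} → length u ≤ i → at (u ++ v) i ≡ at v (i ∸ length u)
at-++ʳ []      v         _          = refl
at-++ʳ (x ∷ u) v {suc i} (s≤s u≤i) = at-++ʳ u v u≤i

at-drop : ∀ w i x → at (drop i w) x ≡ at w (i + x)
at-drop w       zero    x = refl
at-drop []      (suc i) x = refl
at-drop (y ∷ w) (suc i) x = at-drop w i x

at-take : ∀ w {i x} → x < i → at (take i w) x ≡ at w x
at-take []      {suc i}         _         = refl
at-take (y ∷ w) {suc i} {zero}  _         = refl
at-take (y ∷ w) {suc i} {suc x} (s≤s x<i) = at-take w x<i

take-++ˡ : ∀ (u v : Word) {i} → i ≤ length u → take i (u ++ v) ≡ take i u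
take-++ˡ u       v {zero}  _         = refl
take-++ˡ (x ∷ u) v {suc i} (s≤s i≤u) = cong (x ∷_) (take-++ˡ u v i≤u)

take-length-++ : ∀ (u v : Word) n → take (length u + n) (u ++ v) ≡ u ++ take n v
take-length-++ []      v n = refl
take-length-++ (x ∷ u) v n = cong (x ∷_) (take-length-++ u v n)

isPrefix⇒take≡ : ∀ u v → isPrefix u v ≡ true → take (length u) v ≡ u
isPrefix⇒take≡ []      v       _ = refl
isPrefix⇒take≡ (a ∷ u) (a ∷ v) p = cong (a ∷_) (isPrefix⇒take≡ u v p)
isPrefix⇒take≡ (b ∷ u) (b ∷ v) p = cong (b ∷_) (isPrefix⇒take≡ u v p)

take≡⇒isPrefix : ∀ u v → take (length u) v ≡ u → isPrefix u v ≡ true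
take≡⇒isPrefix []      v       _ = refl
take≡⇒isPrefix (a ∷ u) (a ∷ v) e = take≡⇒isPrefix u v (∷-injectiveʳ e)
take≡⇒isPrefix (b ∷ u) (b ∷ v) e = take≡⇒isPrefix u v (∷-injectiveʳ e)

isPrefix⇒≤ : ∀ u v → isPrefix u v ≡ true → length u ≤ length v
isPrefix⇒≤ []      v       _ = z≤n
isPrefix⇒≤ (a ∷ u) (a ∷ v) p = s≤s (isPrefix⇒≤ u v p)
isPrefix⇒≤ (b ∷ u) (b ∷ v) p = s≤s (isPrefix⇒≤ u v p)

occ-shorter : ∀ u w → length w < length u → occ u w ≡ 0
occ-shorter u []      w<u rewrite ¬-not (<⇒≱ w<u ∘ isPrefix⇒≤ u []) = refl
occ-shorter u (x ∷ w) w<u rewrite ¬-not (<⇒≱ w<u ∘ isPrefix⇒≤ u (x ∷ w)) =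
  occ-shorter u w (<-trans (n<1+n _) w<u)

occ-sameLength : ∀ u w → length w ≡ length u → w ≢ u → occ u w ≡ 0
occ-sameLength []      []      _   w≢u = ⊥-elim (w≢u refl)
occ-sameLength u       (x ∷ w) w=u w≢u
  rewrite ¬-not {isPrefix u (x ∷ w)}
                (λ p → w≢u (trans (sym (take-all (length u) (x ∷ w) (≤-reflexive w=u)))
                                  (isPrefix⇒take≡ u (x ∷ w) p)))
  = occ-shorter u w (subst (length w <_) w=u (n<1+n _))

countBelow : (ℕ → Bool) → ℕ → ℕ
countBelow f zero    = 0
countBelow f (suc n) = (if f 0 then 1 else 0) + countBelow (f ∘ suc) n

countBelow-none : ∀ f n → (∀ {i} → i < n → f i ≡ false) → countBelow f n ≡ 0
countBelow-none f zero    _ = refl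
countBelow-none f (suc n) h rewrite h {0} (s≤s z≤n) = countBelow-none (f ∘ suc) n (h ∘ s≤s)

countBelow-unique : ∀ f n {j} → j < n → f j ≡ true → (∀ {i} → i < n → i ≢ j → f i ≡ false) →
                    countBelow f n ≡ 1
countBelow-unique f (suc n) {zero}  _         fj h rewrite fj =
  cong suc (countBelow-none (f ∘ suc) n (λ i<n → h (s≤s i<n) (λ ())))
countBelow-unique f (suc n) {suc j} (s≤s j<n) fj h rewrite h {0} (s≤s z≤n) (λ ()) =
  countBelow-unique (f ∘ suc) n j<n fj (λ i<n i≢j → h (s≤s i<n) (i≢j ∘ suc-injective))

occ-++ : ∀ u x y → occ u (x ++ y) ≡ countBelow (λ i → isPrefix u (drop i x ++ y)) (length x) + occ u y
occ-++ u []      y = refl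
occ-++ u (c ∷ x) y = trans (cong (here +_) (occ-++ u x y)) (sym (+-assoc here _ (occ u y)))
  where here = if isPrefix u (c ∷ x ++ y) then 1 else 0

#b : Word → ℕ
#b []      = 0
#b (a ∷ w) = #b w
#b (b ∷ w) = suc (#b w)

#b-++ : ∀ u v → #b (u ++ v) ≡ #b u + #b v
#b-++ []      v = refl
#b-++ (a ∷ u) v = #b-++ u v
#b-++ (b ∷ u) v = cong suc (#b-++ u v)

#b-rotate : ∀ i w → #b (rotate i w) ≡ #b w
#b-rotate i w = begin
  #b (drop i w ++ take i w)       ≡⟨ #b-++ (drop i w) (take i w) ⟩
  #b (drop i w) + #b (take i w)   ≡⟨ +-comm (#b (drop i w)) _ ⟩
  #b (take i w) + #b (drop i w)   ≡⟨ #b-++ (take i w) (drop i w) ⟨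
  #b (take i w ++ drop i w)       ≡⟨ cong #b (take++drop≡id i w) ⟩
  #b w                            ∎
  where open ≡-Reasoning

length-rotate : ∀ i (w : Word) → length (rotate i w) ≡ length w
length-rotate i w = begin
  length (drop i w ++ take i w)           ≡⟨ length-++ (drop i w) ⟩
  length (drop i w) + length (take i w)   ≡⟨ +-comm (length (drop i w)) _ ⟩
  length (take i w) + length (drop i w)   ≡⟨ length-++ (take i w) ⟨
  length (take i w ++ drop i w)           ≡⟨ cong length (take++drop≡id i w) ⟩
  length w                                ∎
  where open ≡-Reasoning

#b-hat : ∀ w → 0 < length w → #b (hat w) ≢ #b w
#b-hat (a ∷ [])    _ ()
#b-hat (b ∷ [])    _ ()
#b-hat (a ∷ y ∷ w) _ e = #b-hat (y ∷ w) (s≤s z≤n) e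
#b-hat (b ∷ y ∷ w) _ e = #b-hat (y ∷ w) (s≤s z≤n) (suc-injective e)

length-hat : ∀ w → length (hat w) ≡ length w
length-hat []          = refl
length-hat (x ∷ [])    = refl
length-hat (x ∷ y ∷ w) = cong suc (length-hat (y ∷ w))

take-hat : ∀ w {i} → i < length w → take i (hat w) ≡ take i w
take-hat w           {zero}  _           = refl
take-hat (x ∷ y ∷ w) {suc i} (s≤s i<yw) = cong (x ∷_) (take-hat (y ∷ w) i<yw)

at-hat-last : ∀ x w → at (hat (x ∷ w)) (length w) ≡ flip (at (x ∷ w) (length w))
at-hat-last x []      = refl
at-hat-last x (y ∷ w) = at-hat-last y w

flip≢ : ∀ x → flip x ≢ x
flip≢ a ()
flip≢ b ()

length-drop-+ : ∀ (w : Word) {i} → i ≤ length w → length (drop i w) + i ≡ length w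
length-drop-+ w {i} i≤w = trans (cong (_+ i) (length-drop i w)) (m∸n+n≡m i≤w)

take-drop-++ : ∀ (W z : Word) {i} → i ≤ length W → take i z ≡ take i W →
               take (length W) (drop i W ++ z) ≡ rotate i W
take-drop-++ W z {i} i≤W z~W = begin
  take (length W) (drop i W ++ z)                 ≡⟨ cong (λ m → take m (drop i W ++ z)) (length-drop-+ W i≤W) ⟨
  take (length (drop i W) + i) (drop i W ++ z)    ≡⟨ take-length-++ (drop i W) z i ⟩
  drop i W ++ take i z                            ≡⟨ cong (drop i W ++_) z~W ⟩
  rotate i W                                      ∎
  where open ≡-Reasoning

isPrefix-drop-++⇔rotate≡ : ∀ (W z u : Word) {i} → length u ≡ length W → i ≤ length W → take i z ≡ take i W →
                           isPrefix u (drop i W ++ z) ≡ true ⇔ rotate i W ≡ u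
isPrefix-drop-++⇔rotate≡ W z u {i} u=W i≤W z~W = mk⇔
  (λ p → trans (sym (take-drop-++ W z i≤W z~W))
               (subst (λ m → take m (drop i W ++ z) ≡ u) u=W (isPrefix⇒take≡ u _ p)))
  (λ r → take≡⇒isPrefix u _
           (trans (cong (λ m → take m (drop i W ++ z)) u=W) (trans (take-drop-++ W z i≤W z~W) r)))

-- Cyclic periods

module Cyclic (w : Word) {{_ : NonZero (length w)}} where

  N : ℕ
  N = length w

  letter : ℕ → Letter
  letter y = at w (y % N)

  Period : ℕ → Set
  Period d = ∀ y → letter (y + d) ≡ letter y

  letter-< : ∀ {y} → y < N → letter y ≡ at w y
  letter-< y<N = cong (at w) (m<n⇒m%n≡m y<N)

  letter-+* : ∀ y q → letter (y + q * N) ≡ letter y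
  letter-+* y q = cong (at w) ([m+kn]%n≡m%n y q N)

  period-length : Period N
  period-length y = trans (cong letter (cong (y +_) (sym (+-identityʳ N)))) (letter-+* y 1)

  period-+ : ∀ {c d} → Period c → Period d → Period (c + d)
  period-+ {c} {d} pc pd y = trans (cong letter (sym (+-assoc y c d))) (trans (pd (y + c)) (pc y))

  period-* : ∀ {d} → Period d → ∀ t → Period (t * d)
  period-* pd zero    y = cong letter (+-identityʳ y)
  period-* pd (suc t)   = period-+ pd (period-* pd t)

  period-cancelʳ : ∀ {c} g → Period c → Period (g + c) → Period g
  period-cancelʳ {c} g pc pgc y = trans (sym (pc (y + g))) (trans (cong letter (+-assoc y g c)) (pgc y))

  period-gcd : ∀ {d} → Period d → Period (gcd d N)
  period-gcd {d} pd with Bézout.identity (gcd-GCD d N)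
  ... | Bézout.Identity.+- x y eq =
    period-cancelʳ _ (period-* period-length y) (subst Period (sym eq) (period-* pd x))
  ... | Bézout.Identity.-+ x y eq =
    period-cancelʳ _ (period-* pd x) (subst Period (sym eq) (period-* period-length y))

  letter-%-+ : ∀ x k → letter (x % N + k) ≡ letter (x + k)
  letter-%-+ x k = begin
    letter (x % N + k)               ≡⟨ letter-+* (x % N + k) (x / N) ⟨
    letter (x % N + k + x / N * N)   ≡⟨ cong letter (shuffle (x % N) k (x / N * N)) ⟩
    letter (x % N + x / N * N + k)   ≡⟨ cong (λ m → letter (m + k)) (m≡m%n+[m/n]*n x N) ⟨
    letter (x + k)                   ∎
    where
    open ≡-Reasoning
    shuffle : ∀ r k m → r + k + m ≡ r + m + k
    shuffle = solve-∀

  at-rotate : ∀ {i x} → i ≤ N → x < N → at (rotate i w) x ≡ letter (x + i)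
  at-rotate {i} {x} i≤N x<N with x <? length (drop i w)
  ... | yes x<D = begin
    at (drop i w ++ take i w) x   ≡⟨ at-++ˡ (drop i w) (take i w) x<D ⟩
    at (drop i w) x               ≡⟨ at-drop w i x ⟩
    at w (i + x)                  ≡⟨ cong (at w) (+-comm i x) ⟩
    at w (x + i)                  ≡⟨ letter-< (subst (x + i <_) (length-drop-+ w i≤N) (+-monoˡ-< i x<D)) ⟨
    letter (x + i)                ∎
    where open ≡-Reasoning
  ... | no x≮D = begin
    at (drop i w ++ take i w) x   ≡⟨ at-++ʳ (drop i w) (take i w) D≤x ⟩
    at (take i w) x′              ≡⟨ at-take w x′<i ⟩
    at w x′                       ≡⟨ letter-< (≤-trans x′<i i≤N) ⟨
    letter x′                     ≡⟨ period-length x′ ⟨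
    letter (x′ + N)               ≡⟨ cong letter x′+N=x+i ⟩
    letter (x + i)                ∎
    where
    open ≡-Reasoning
    D : ℕ
    D = length (drop i w)
    D≤x : D ≤ x
    D≤x = ≮⇒≥ x≮D
    x′ : ℕ
    x′ = x ∸ D
    x′+D=x : x′ + D ≡ x
    x′+D=x = m∸n+n≡m D≤x
    x′+N=x+i : x′ + N ≡ x + i
    x′+N=x+i = trans (cong (x′ +_) (sym (length-drop-+ w i≤N)))
                     (trans (sym (+-assoc x′ D i)) (cong (_+ i) x′+D=x))
    x′<i : x′ < i
    x′<i = +-cancelʳ-< D x′ i
             (subst₂ _<_ (sym x′+D=x) (trans (sym (length-drop-+ w i≤N)) (+-comm D i)) x<N)

  rotate≡⇒period : ∀ {i j} → i < j → j ≤ N → rotate i w ≡ rotate j w → Period (j ∸ i)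
  rotate≡⇒period {i} {j} i<j j≤N r y = begin
    letter (y + d)                   ≡⟨ period-length (y + d) ⟨
    letter (y + d + N)               ≡⟨ cong letter (sym shift-j) ⟩
    letter (y + (N ∸ i) + j)         ≡⟨ shifts-agree (y + (N ∸ i)) ⟨
    letter (y + (N ∸ i) + i)         ≡⟨ cong letter shift-i ⟩
    letter (y + N)                   ≡⟨ period-length y ⟩
    letter y                         ∎
    where
    open ≡-Reasoning
    d : ℕ
    d = j ∸ i
    i≤N : i ≤ N
    i≤N = ≤-trans (<⇒≤ i<j) j≤N
    shifts-agree : ∀ x → letter (x + i) ≡ letter (x + j)
    shifts-agree x = begin
      letter (x + i)          ≡⟨ letter-%-+ x i ⟨
      letter (x % N + i)      ≡⟨ at-rotate i≤N (m%n<n x N) ⟨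
      at (rotate i w) (x % N) ≡⟨ cong (λ v → at v (x % N)) r ⟩
      at (rotate j w) (x % N) ≡⟨ at-rotate j≤N (m%n<n x N) ⟩
      letter (x % N + j)      ≡⟨ letter-%-+ x j ⟩
      letter (x + j)          ∎
    shift-i : y + (N ∸ i) + i ≡ y + N
    shift-i = trans (+-assoc y (N ∸ i) i) (cong (y +_) (m∸n+n≡m i≤N))
    swap : ∀ y p q i → y + p + (q + i) ≡ y + q + (p + i)
    swap = solve-∀
    shift-j : y + (N ∸ i) + j ≡ y + d + N
    shift-j = begin
      y + (N ∸ i) + j             ≡⟨ cong (y + (N ∸ i) +_) (m∸n+n≡m (<⇒≤ i<j)) ⟨
      y + (N ∸ i) + (d + i)       ≡⟨ swap y (N ∸ i) d i ⟩
      y + d + ((N ∸ i) + i)       ≡⟨ cong (y + d +_) (m∸n+n≡m i≤N) ⟩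
      y + d + N                   ∎

half-not-period : ∀ u → 0 < length u → {{_ : NonZero (length (u ++ hat u))}} →
                  ¬ Cyclic.Period (u ++ hat u) (length u)
half-not-period u@(x ∷ t) _ period = flip≢ (at u (length t)) (begin
  flip (at u (length t))            ≡⟨ at-hat-last x t ⟨
  at (hat u) (length t)             ≡⟨ cong (at (hat u)) (m+n∸n≡m (length t) (length u)) ⟨
  at (hat u) (length t + length u ∸ length u)
                                    ≡⟨ at-++ʳ u (hat u) (m≤n+m (length u) (length t)) ⟨
  at (u ++ hat u) (length t + length u)
                                    ≡⟨ letter-< (subst (length t + length u <_) (sym N=2u)
                                                       (+-monoˡ-< (length u) (n<1+n _))) ⟨
  letter (length t + length u)      ≡⟨ period (length t) ⟩
  letter (length t)                 ≡⟨ letter-< (subst (length t <_) (sym N=2u)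
                                                       (≤-trans (n<1+n _) (m≤m+n _ _))) ⟩
  at (u ++ hat u) (length t)        ≡⟨ at-++ˡ u (hat u) (n<1+n _) ⟩
  at u (length t)                   ∎)
  where
  open ≡-Reasoning
  open Cyclic (u ++ hat u)
  N=2u : N ≡ length u + length u
  N=2u = trans (length-++ u) (cong (length u +_) (length-hat u))

∣2^[1+m]⇒∣2^m : ∀ m {g} → g ∣ 2 ^ suc m → g < 2 ^ suc m → g ∣ 2 ^ m
∣2^[1+m]⇒∣2^m m {g} (divides q 2^[1+m]=q*g) g<
  with euclidsLemma q g prime[2] (divides (2 ^ m) (trans (sym 2^[1+m]=q*g) (*-comm 2 (2 ^ m))))
... | inj₁ (divides r q=r*2) = divides r (*-cancelˡ-≡ _ _ 2 (begin
  2 * 2 ^ m     ≡⟨ 2^[1+m]=q*g ⟩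
  q * g         ≡⟨ cong (_* g) q=r*2 ⟩
  r * 2 * g     ≡⟨ rearrange r g ⟩
  2 * (r * g)   ∎))
  where
  open ≡-Reasoning
  rearrange : ∀ r g → r * 2 * g ≡ 2 * (r * g)
  rearrange = solve-∀
... | inj₂ (divides h g=h*2) = subst (_∣ 2 ^ m) (sym g=h*2) (h*2∣2^m m h∣2^m h<2^m)
  where
  h∣2^m : h ∣ 2 ^ m
  h∣2^m = divides q (*-cancelʳ-≡ _ _ 2 (begin
    2 ^ m * 2     ≡⟨ *-comm (2 ^ m) 2 ⟩
    2 * 2 ^ m     ≡⟨ 2^[1+m]=q*g ⟩
    q * g         ≡⟨ cong (q *_) g=h*2 ⟩
    q * (h * 2)   ≡⟨ *-assoc q h 2 ⟨
    q * h * 2     ∎))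
    where open ≡-Reasoning
  h<2^m : h < 2 ^ m
  h<2^m = *-cancelʳ-< 2 h (2 ^ m) (subst₂ _<_ g=h*2 (*-comm 2 (2 ^ m)) g<)
  h*2∣2^m : ∀ m → h ∣ 2 ^ m → h < 2 ^ m → h * 2 ∣ 2 ^ m
  h*2∣2^m zero    h∣1 h<1 with () ← 0∣⇒≡0 (subst (_∣ 1) (n<1⇒n≡0 h<1) h∣1)
  h*2∣2^m (suc m) h∣2^[1+m] h<2^[1+m] =
    subst (h * 2 ∣_) (*-comm (2 ^ m) 2) (*-monoˡ-∣ 2 (∣2^[1+m]⇒∣2^m m h∣2^[1+m] h<2^[1+m]))

-- The rotations of S n are pairwise distinct

length-S : ∀ n → length (S n) ≡ 2 ^ n
length-S zero    = refl
length-S (suc n) = begin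
  length (S n ++ hat (S n))           ≡⟨ length-++ (S n) ⟩
  length (S n) + length (hat (S n))   ≡⟨ cong (length (S n) +_) (length-hat (S n)) ⟩
  length (S n) + length (S n)         ≡⟨ cong (λ m → m + m) (length-S n) ⟩
  2 ^ n + 2 ^ n                       ≡⟨ cong (2 ^ n +_) (+-identityʳ (2 ^ n)) ⟨
  2 ^ suc n                           ∎
  where open ≡-Reasoning

0<length-S : ∀ n → 0 < length (S n)
0<length-S n = subst (0 <_) (sym (length-S n)) (m^n>0 2 n)

nonZero-length-S : ∀ n → NonZero (length (S n))
nonZero-length-S n = >-nonZero (0<length-S n)

rotate-S-≢ : ∀ n {i j} → i < j → j < length (S n) → rotate i (S n) ≢ rotate j (S n)
rotate-S-≢ zero    {j = suc j} i<j (s≤s ())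
rotate-S-≢ (suc m) {i} {j} i<j j<N r =
  half-not-period (S m) (0<length-S m) {{nonZero-length-S (suc m)}} (subst Period (sym S-m=c*g) (period-* period-g c))
  where
  open Cyclic (S (suc m)) {{nonZero-length-S (suc m)}}
  d g : ℕ
  d = j ∸ i
  g = gcd d N
  period-g : Period g
  period-g = period-gcd (rotate≡⇒period i<j (<⇒≤ j<N) r)
  g<N : g < N
  g<N = ≤-<-trans (∣⇒≤ {{>-nonZero (m<n⇒0<n∸m i<j)}} (gcd[m,n]∣m d N)) (≤-<-trans (m∸n≤m j i) j<N)
  g∣2^m : g ∣ 2 ^ m
  g∣2^m = ∣2^[1+m]⇒∣2^m m (subst (g ∣_) (length-S (suc m)) (gcd[m,n]∣n d N))
                           (subst (g <_) (length-S (suc m)) g<N)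
  c : ℕ
  c = _∣_.quotient g∣2^m
  S-m=c*g : length (S m) ≡ c * g
  S-m=c*g = trans (length-S m) (_∣_.equality g∣2^m)

rotate-S-injective : ∀ n {i j} → i < length (S n) → j < length (S n) → rotate i (S n) ≡ rotate j (S n) → i ≡ j
rotate-S-injective n {i} {j} i<N j<N r with <-cmp i j
... | tri< i<j _ _ = ⊥-elim (rotate-S-≢ n i<j j<N r)
... | tri≈ _ i=j _ = i=j
... | tri> _ _ j<i = ⊥-elim (rotate-S-≢ n j<i i<N (sym r))

-- Occurrences of a proper rotation of a word with distinct rotations

module Occurrences (A : Word)
  (rotate-injective : ∀ {i j} → i < length A → j < length A → rotate i A ≡ rotate j A → i ≡ j)
  {j : ℕ} (j<A : j < length A) (proper : rotate j A ≢ A) where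

  α B : Word
  α = rotate j A
  B = hat A

  α=A : length α ≡ length A
  α=A = length-rotate j A

  rotate-B≢α : ∀ i → rotate i B ≢ α
  rotate-B≢α i r = #b-hat A (≤-<-trans z≤n j<A) (begin
    #b B              ≡⟨ #b-rotate i B ⟨
    #b (rotate i B)   ≡⟨ cong #b r ⟩
    #b α              ≡⟨ #b-rotate j A ⟩
    #b A              ∎)
    where open ≡-Reasoning

  occ-α-leading-A : ∀ z → (∀ {i} → i < length A → take i z ≡ take i A) →
                    countBelow (λ i → isPrefix α (drop i A ++ z)) (length A) ≡ 1
  occ-α-leading-A z z~A = countBelow-unique _ (length A) j<A
    (Equivalence.from (match j<A) refl)
    (λ i<A i≢j → ¬-not (i≢j ∘ rotate-injective i<A j<A ∘ Equivalence.to (match i<A)))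
    where
    match : ∀ {i} → i < length A → isPrefix α (drop i A ++ z) ≡ true ⇔ rotate i A ≡ α
    match i<A = isPrefix-drop-++⇔rotate≡ A z α α=A (<⇒≤ i<A) (z~A i<A)

  occ-α-A : occ α A ≡ 0
  occ-α-A = occ-sameLength α A (sym α=A) (proper ∘ sym)

  occ-α-B : occ α B ≡ 0
  occ-α-B = occ-sameLength α B (trans (length-hat A) (sym α=A)) (rotate-B≢α 0 ∘ trans (++-identityʳ B))

  occ-α-AAA : occ α (A ++ A ++ A) ≡ 2
  occ-α-AAA = begin
    occ α (A ++ A ++ A)   ≡⟨ occ-++ α A (A ++ A) ⟩
    _ + occ α (A ++ A)    ≡⟨ cong (_+ occ α (A ++ A)) (occ-α-leading-A (A ++ A) (λ i<A → take-++ˡ A A (<⇒≤ i<A))) ⟩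
    1 + occ α (A ++ A)    ≡⟨ cong suc (occ-++ α A A) ⟩
    1 + (_ + occ α A)     ≡⟨ cong₂ (λ m n → 1 + (m + n)) (occ-α-leading-A A (λ _ → refl)) occ-α-A ⟩
    2                     ∎
    where open ≡-Reasoning

  occ-α-AB : occ α (A ++ B) ≡ 1
  occ-α-AB = trans (occ-++ α A B) (cong₂ _+_ (occ-α-leading-A B (take-hat A)) occ-α-B)

  occ-α-BA : occ α (B ++ A) ≡ 0
  occ-α-BA = trans (occ-++ α B A) (cong₂ _+_ (countBelow-none _ (length B) no-match) occ-α-A)
    where
    no-match : ∀ {i} → i < length B → isPrefix α (drop i B ++ A) ≡ false
    no-match {i} i<B = ¬-not (rotate-B≢α i ∘ Equivalence.to
      (isPrefix-drop-++⇔rotate≡ B A α (trans α=A (sym (length-hat A))) (<⇒≤ i<B)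
        (sym (take-hat A (subst (i <_) (length-hat A) i<B)))))

lemma5 : (k : ℕ) → 3 ≤ k → (j : ℕ) → j < length (S (k ∸ 2)) →
         rotate j (S (k ∸ 2)) ≢ S (k ∸ 2) →
         (occ (rotate j (S (k ∸ 2))) (S (k ∸ 2) ++ S (k ∸ 2) ++ S (k ∸ 2)) ≡ 2)
         × (occ (rotate j (S (k ∸ 2))) (S (k ∸ 2) ++ hat (S (k ∸ 2))) ≡ 1)
         × (occ (rotate j (S (k ∸ 2))) (hat (S (k ∸ 2)) ++ S (k ∸ 2)) ≡ 0)
lemma5 k _ j j<A proper = occ-α-AAA , occ-α-AB , occ-α-BA
  where open Occurrences (S (k ∸ 2)) (rotate-S-injective (k ∸ 2)) j<A proper
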